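{- Let $\mathcal{O}\subseteq\mathcal{O}'$ be orders of a number field $K$, let $\mathfrak{f}=\mathfrak{f}_{\mathcal{O}'}(\mathcal{O})$ be the relative conductor, and let $\mathfrak{m}'$ be an integral $\mathcal{O}'$-ideal with $\mathfrak{m}'\subseteq\mathfrak{f}$ (so $\mathfrak{m}'$ is also an integral $\mathcal{O}$-ideal). Then the contraction map $\mathrm{con}(\mathfrak{a}')=\mathfrak{a}'\cap\mathcal{O}$ on integral $\mathcal{O}'$-ideals coprime to $\mathfrak{m}'$ and the extension map $\mathrm{ext}(\mathfrak{a})=\mathfrak{a}\mathcal{O}'$ on integral $\mathcal{O}$-ideals coprime to $\mathfrak{m}'$ extend uniquely to isomorphisms (for ideal multiplication) between the fractional ideals coprime to $\mathfrak{m}'$; that is, the maps $\mathrm{con}:J_{\mathfrak{m}'}(\mathcal{O}')\to J_{\mathfrak{m}'}(\mathcal{O})$ and $\mathrm{ext}:J_{\mathfrak{m}'}(\mathcal{O})\to J_{\mathfrak{m}'}(\mathcal{O}')$ are well-defined and are inverses of each other.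
   Context: Orders: subrings of $K$ containing $1$ that are free $\mathbb{Z}$-modules of rank $[K:\mathbb{Q}]$. Relative conductor: $\mathfrak{f}_{\mathcal{O}'}(\mathcal{O})=(\mathcal{O}:\mathcal{O}')=\{\alpha\in\mathcal{O}':\alpha\mathcal{O}'\subseteq\mathcal{O}\}$, the largest $\mathcal{O}'$-ideal contained in $\mathcal{O}$. For an order $\mathcal{R}$: a fractional $\mathcal{R}$-ideal is an $\mathcal{R}$-submodule $\mathfrak{a}\subseteq K$ with $\lambda\mathfrak{a}\subseteq\mathcal{R}$ for some $\lambda\in K^\times$; invertible if $\mathfrak{a}\mathfrak{b}=\mathcal{R}$ for some fractional $\mathfrak{b}$; $(\mathfrak{a}:\mathfrak{b})=\{x\in K:x\mathfrak{b}\subseteq\mathfrak{a}\}$; a fractional ideal is coprime to an integral ideal $\mathfrak{c}$ if it equals $(\mathfrak{a}:\mathfrak{b})$ with $\mathfrak{a}$ integral, $\mathfrak{b}$ integral invertible, and $\mathfrak{a}+\mathfrak{c}=\mathfrak{b}+\mathfrak{c}=\mathcal{R}$; $J_\mathfrak{c}(\mathcal{R})$ denotes the set of fractional $\mathcal{R}$-ideals coprime to $\mathfrak{c}$. -}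

module Defs where

open import Level using (0ℓ)
open import Algebra.Bundles using (CommutativeRing)
open import Data.Nat using (ℕ; zero; suc)
open import Data.Integer using (ℤ; +_; -[1+_])
open import Data.Fin using (Fin)
open import Data.List using (List; []; _∷_; map)
open import Data.List.Relation.Unary.All using (All)
open import Data.Product using (Σ; ∃; _×_; _,_; proj₁; proj₂)
open import Relation.Nullary using (¬_)
open import Relation.Unary using (Pred)
open import Relation.Binary.PropositionalEquality using (_≡_)

-- A number field: a field K (commutative ring, 1 ≠ 0, nonzero elements
-- invertible) of characteristic 0, together with its degree n = [K:ℚ]
-- and a ℚ-basis e₀,…,e_{n-1} (spanning: every x has d·x = Σ cᵢ eᵢ with
-- d a nonzero integer, cᵢ integers; independence over ℚ, equivalently
-- over ℤ after clearing denominators).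

module RingOps (R : CommutativeRing 0ℓ 0ℓ) where
  open CommutativeRing R

  natsc : ℕ → Carrier → Carrier
  natsc zero    x = 0#
  natsc (suc n) x = x + natsc n x

  zsc : ℤ → Carrier → Carrier
  zsc (+ n)      x = natsc n x
  zsc -[1+ n ]   x = - natsc (suc n) x

  sumFin : ∀ n → (Fin n → Carrier) → Carrier
  sumFin zero    f = 0#
  sumFin (suc n) f = f Fin.zero + sumFin n (λ i → f (Fin.suc i))
    where import Data.Fin as Fin

  sumL : List Carrier → Carrier
  sumL []       = 0#
  sumL (x ∷ xs) = x + sumL xs

  lincomb : ∀ n → (Fin n → ℤ) → (Fin n → Carrier) → Carrier
  lincomb n c b = sumFin n (λ i → zsc (c i) (b i))

record NumberField : Set₁ where
  field
    cring : CommutativeRing 0ℓ 0ℓ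
  open CommutativeRing cring public
  open RingOps cring public
  field
    1≉0      : ¬ (1# ≈ 0#)
    inverse  : ∀ x → ¬ (x ≈ 0#) → Σ Carrier (λ y → (x * y) ≈ 1#)
    char0    : ∀ n → ¬ (n ≡ 0) → ¬ (natsc n 1# ≈ 0#)
    degree   : ℕ
    basis    : Fin degree → Carrier
    spans    : ∀ x → Σ ℤ (λ d → ¬ (d ≡ + 0) ×
                 Σ (Fin degree → ℤ) (λ c → zsc d x ≈ lincomb degree c basis))
    indep    : ∀ (c : Fin degree → ℤ) → lincomb degree c basis ≈ 0# →
               ∀ i → c i ≡ + 0

module _ (K : NumberField) where
  open NumberField K

  Subset : Set₁
  Subset = Pred Carrier 0ℓ

  _⊆K_ : Subset → Subset → Set
  A ⊆K B = ∀ x → A x → B x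

  _≐K_ : Subset → Subset → Set
  A ≐K B = (A ⊆K B) × (B ⊆K A)

  Respects≈ : Subset → Set
  Respects≈ A = ∀ {x y} → x ≈ y → A x → A y

  record IsOrder (O : Subset) : Set where
    field
      resp     : Respects≈ O
      has-1    : O 1#
      +-closed : ∀ {x y} → O x → O y → O (x + y)
      neg-closed : ∀ {x} → O x → O (- x)
      *-closed : ∀ {x y} → O x → O y → O (x * y)
      zbasis   : Fin degree → Carrier
      zbasis∈  : ∀ i → O (zbasis i)
      zspans   : ∀ x → O x → Σ (Fin degree → ℤ) (λ c → x ≈ lincomb degree c zbasis)
      zindep   : ∀ (c : Fin degree → ℤ) → lincomb degree c zbasis ≈ 0# →
                 ∀ i → c i ≡ + 0

  _∩K_ : Subset → Subset → Subset
  (A ∩K B) x = A x × B x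

  _+K_ : Subset → Subset → Subset
  (A +K B) x = Σ Carrier (λ y → Σ Carrier (λ z → A y × B z × x ≈ (y + z)))

  _·K_ : Subset → Subset → Subset
  (A ·K B) x = Σ (List (Carrier × Carrier)) (λ ps →
                 All (λ p → A (proj₁ p) × B (proj₂ p)) ps ×
                 x ≈ sumL (map (λ p → proj₁ p * proj₂ p) ps))

  _:K_ : Subset → Subset → Subset
  (A :K B) x = ∀ y → B y → A (x * y)

  record IsSubmodule (R A : Subset) : Set where
    field
      resp     : Respects≈ A
      has-0    : A 0#
      +-closed : ∀ {x y} → A x → A y → A (x + y)
      neg-closed : ∀ {x} → A x → A (- x)
      R-closed : ∀ {r x} → R r → A x → A (r * x)

  IsFractional : Subset → Subset → Set
  IsFractional R A = IsSubmodule R A ×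
    Σ Carrier (λ l → ¬ (l ≈ 0#) × (∀ x → A x → R (l * x)))

  IsIntegral : Subset → Subset → Set
  IsIntegral R A = IsSubmodule R A × (A ⊆K R)

  IsInvertible : Subset → Subset → Set₁
  IsInvertible R A = IsFractional R A ×
    Σ Subset (λ B → IsFractional R B × ((A ·K B) ≐K R))

  CoprimeTo : Subset → Subset → Subset → Set₁
  CoprimeTo R c X = Σ Subset (λ a → Σ Subset (λ b →
    IsIntegral R a × IsIntegral R b × IsInvertible R b ×
    ((a +K c) ≐K R) × ((b +K c) ≐K R) × (X ≐K (a :K b))))

  InJ : Subset → Subset → Subset → Set₁
  InJ R c X = IsFractional R X × CoprimeTo R c X

  IntCoprime : Subset → Subset → Subset → Set
  IntCoprime R c A = IsIntegral R A × ((A +K c) ≐K R)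

  conductor : Subset → Subset → Subset
  conductor O O' α = O' α × (∀ y → O' y → O (α * y))

  record IsMultExtension (c R S : Subset) (f F : Subset → Subset) : Set₁ where
    field
      maps-J   : ∀ A → InJ R c A → InJ S c (F A)
      resp-≐   : ∀ A B → InJ R c A → InJ R c B → A ≐K B → F A ≐K F B
      mult     : ∀ A B → InJ R c A → InJ R c B → F (A ·K B) ≐K (F A ·K F B)
      extends  : ∀ A → IntCoprime R c A → F A ≐K f A

  UniqueMultExtension : (c R S : Subset) (f F : Subset → Subset) → Set₁
  UniqueMultExtension c R S f F = IsMultExtension c R S f F ×
    (∀ G → IsMultExtension c R S f G → ∀ A → InJ R c A → G A ≐K F A)

-- Let O₍c₎ be the ring of x ∈ K with s x ∈ O for some s ≡ 1 mod c. Contraction of fractional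
-- O'-ideals is X ↦ X ∩ O₍c₎; on integral ideals this is X ∩ O, because c O' ⊆ O. An ideal coprime
-- to c contains some α ≡ 1 mod c, and splitting elements as z = α z + g z with g ∈ c yields
-- (I O') ∩ O₍c₎ = I for O-ideals I and (X ∩ O₍c₎) O' = X for O'-ideals X. The second identity gives
-- multiplicativity of contraction, hence that it keeps the denominator of a quotient (a : b)
-- invertible. Uniqueness holds because a multiplicative extension is determined on (a : b) by
-- its values on the integral ideals a and b.
module Submission where

open import Level using (0ℓ) renaming (suc to lsuc)
open import Data.Fin using (Fin)
import Data.Fin as Fin
open import Data.Fin.Properties using (all?)
open import Data.Integer using (ℤ; +_; -[1+_])
open import Data.Integer.Properties using (_≟_)
open import Data.List using (List; []; _∷_; map; _++_)
open import Data.List.Relation.Unary.All using (All; []; _∷_)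
open import Data.List.Relation.Unary.All.Properties using (++⁺)
open import Data.Maybe using (nothing)
open import Data.Nat using (zero; suc)
open import Data.Product using (Σ; _×_; _,_; proj₁; proj₂)
open import Relation.Binary.Bundles using (Preorder)
import Relation.Binary.Reasoning.Preorder
import Relation.Binary.Reasoning.Setoid as ≈-Reasoning
open import Relation.Binary.PropositionalEquality using (_≡_) renaming (refl to ≡-refl)
open import Relation.Nullary using (¬_; Dec; yes; no)
import Algebra.Properties.Ring as RingProperties
import Algebra.Solver.CommutativeMonoid as MonoidSolver
open import Tactic.RingSolver.Core.AlmostCommutativeRing using (AlmostCommutativeRing; fromCommutativeRing)
import Tactic.RingSolver.NonReflective as RingSolver
open import Defs

module FieldFacts (K : NumberField) where
  open NumberField K
  open RingProperties ring using (-‿distribˡ-*; -‿injective; -0#≈0#)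

  private
    K-ring : AlmostCommutativeRing 0ℓ 0ℓ
    K-ring = fromCommutativeRing cring (λ _ → nothing)

  open RingSolver K-ring public using (solve) renaming (_⊕_ to _⊞_; _⊗_ to _⊠_)
  open MonoidSolver *-commutativeMonoid public
    using () renaming (_⊕_ to _⊛_; _⊜_ to _≋_; solve to solve-*)

  -- The solver's own _⊜_ is infixl 6, as tight as _⊞_.
  infix 4 _⊜_
  _⊜_ : {E : Set} → E → E → E × E
  _⊜_ = _,_

  *-splits : ∀ {s g} x → s + g ≈ 1# → s * x + g * x ≈ x
  *-splits {s} {g} x s+g≈1 = trans (sym (distribʳ x s g)) (trans (*-congʳ s+g≈1) (*-identityˡ x))

  natsc≈natsc1* : ∀ n x → natsc n x ≈ natsc n 1# * x
  natsc≈natsc1* zero x = sym (zeroˡ x)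
  natsc≈natsc1* (suc n) x =
    trans (+-cong (sym (*-identityˡ x)) (natsc≈natsc1* n x)) (sym (distribʳ x 1# (natsc n 1#)))

  zsc≈zsc1* : ∀ d x → zsc d x ≈ zsc d 1# * x
  zsc≈zsc1* (+ n)    x = natsc≈natsc1* n x
  zsc≈zsc1* -[1+ n ] x = trans (-‿cong (natsc≈natsc1* (suc n) x)) (-‿distribˡ-* _ x)

  zsc1≉0 : ∀ d → ¬ (d ≡ + 0) → ¬ (zsc d 1# ≈ 0#)
  zsc1≉0 (+ zero)  d≢0 _ = d≢0 ≡-refl
  zsc1≉0 (+ suc n) _ n1≈0 = char0 (suc n) (λ ()) n1≈0
  zsc1≉0 -[1+ n ]  _ -n1≈0 = char0 (suc n) (λ ()) (-‿injective (trans -n1≈0 (sym -0#≈0#)))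

  lincomb-zero : ∀ n (c : Fin n → ℤ) (e : Fin n → Carrier) → (∀ i → c i ≡ + 0) → lincomb n c e ≈ 0#
  lincomb-zero zero    c e c≡0 = refl
  lincomb-zero (suc n) c e c≡0 with c Fin.zero | c≡0 Fin.zero
  ... | .(+ 0) | ≡-refl = trans (+-identityˡ _) (lincomb-zero n _ _ (λ i → c≡0 (Fin.suc i)))

  cancel-nonzero : ∀ {a x} → ¬ (a ≈ 0#) → a * x ≈ 0# → x ≈ 0#
  cancel-nonzero {a} {x} a≉0 ax≈0 with inverse a a≉0
  ... | a⁻¹ , aa⁻¹≈1 =
    trans (sym (*-identityˡ x)) (trans (*-congʳ (trans (sym aa⁻¹≈1) (*-comm a a⁻¹)))
      (trans (*-assoc a⁻¹ a x) (trans (*-congˡ ax≈0) (zeroʳ a⁻¹))))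

  -- x ≈ 0 iff the integer coordinates of some nonzero multiple d x all vanish, which is decidable.
  _≈0? : ∀ x → Dec (x ≈ 0#)
  x ≈0? with spans x
  ... | d , d≢0 , c , dx≈Σ with all? (λ i → c i ≟ + 0)
  ... | yes c≡0 = yes (cancel-nonzero (zsc1≉0 d d≢0)
                         (trans (sym (zsc≈zsc1* d x)) (trans dx≈Σ (lincomb-zero degree c basis c≡0))))
  ... | no c≢0  = no (λ x≈0 → c≢0 (indep c (trans (sym dx≈Σ)
                         (trans (zsc≈zsc1* d x) (trans (*-congˡ x≈0) (zeroʳ _))))))

module Subsets (K : NumberField) where
  open NumberField K
  open FieldFacts K using (_⊜_; solve-*; _⊛_; _≋_)
  open RingProperties ring using (-‿distribʳ-*; -0#≈0#; -‿+-comm)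

  infix  4 _⊆_ _≐_
  infixl 7 _·_
  infixl 6 _⊕_
  infixl 8 _∩_

  _⊆_ _≐_ : Subset K → Subset K → Set
  _⊆_ = _⊆K_ K
  _≐_ = _≐K_ K

  _·_ _∩_ _⊕_ _∶_ : Subset K → Subset K → Subset K
  _·_ = _·K_ K
  _∩_ = _∩K_ K
  _⊕_ = _+K_ K
  _∶_ = _:K_ K

  ⊆-refl : ∀ {A} → A ⊆ A
  ⊆-refl _ Ax = Ax

  ⊆-trans : ∀ {A B C} → A ⊆ B → B ⊆ C → A ⊆ C
  ⊆-trans A⊆B B⊆C x Ax = B⊆C x (A⊆B x Ax)

  ≐-refl : ∀ {A} → A ≐ A
  ≐-refl = ⊆-refl , ⊆-refl

  ≐-sym : ∀ {A B} → A ≐ B → B ≐ A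
  ≐-sym (A⊆B , B⊆A) = B⊆A , A⊆B

  ≐-trans : ∀ {A B C} → A ≐ B → B ≐ C → A ≐ C
  ≐-trans (A⊆B , B⊆A) (B⊆C , C⊆B) = ⊆-trans A⊆B B⊆C , ⊆-trans C⊆B B⊆A

  ⊆-preorder : Preorder (lsuc 0ℓ) 0ℓ 0ℓ
  ⊆-preorder = record
    { Carrier = Subset K ; _≈_ = _≐_ ; _≲_ = _⊆_
    ; isPreorder = record
      { isEquivalence = record { refl = ≐-refl ; sym = ≐-sym ; trans = ≐-trans }
      ; reflexive = proj₁
      ; trans = ⊆-trans } }

  module ⊆-Reasoning = Relation.Binary.Reasoning.Preorder ⊆-preorder

  record AddClosed (D : Subset K) : Set where
    field
      ∈-resp : Respects≈ K D
      0∈     : D 0#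
      +∈     : ∀ {x y} → D x → D y → D (x + y)
  open AddClosed public

  submodule⇒addClosed : ∀ {R A} → IsSubmodule K R A → AddClosed A
  submodule⇒addClosed A-sub = record { ∈-resp = resp ; 0∈ = has-0 ; +∈ = +-closed }
    where open IsSubmodule A-sub

  addClosed-preimage : ∀ {D} → AddClosed D → (f : Carrier → Carrier) →
    (∀ {x y} → x ≈ y → f x ≈ f y) → f 0# ≈ 0# → (∀ x y → f (x + y) ≈ f x + f y) →
    AddClosed (λ x → D (f x))
  addClosed-preimage D-add f f-cong f0≈0 f-+ = record
    { ∈-resp = λ x≈y → ∈-resp D-add (f-cong x≈y)
    ; 0∈     = ∈-resp D-add (sym f0≈0) (0∈ D-add)
    ; +∈     = λ {x} {y} Dfx Dfy → ∈-resp D-add (sym (f-+ x y)) (+∈ D-add Dfx Dfy) }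

  addClosed-*ˡ : ∀ {D} → AddClosed D → ∀ c → AddClosed (λ x → D (c * x))
  addClosed-*ˡ D-add c = addClosed-preimage D-add (c *_) *-congˡ (zeroʳ c) (distribˡ c)

  addClosed-*ʳ : ∀ {D} → AddClosed D → ∀ c → AddClosed (λ x → D (x * c))
  addClosed-*ʳ D-add c = addClosed-preimage D-add (_* c) *-congʳ (zeroˡ c) (λ x y → distribʳ c x y)

  addClosed-neg : ∀ {D} → AddClosed D → AddClosed (λ x → D (- x))
  addClosed-neg D-add = addClosed-preimage D-add -_ -‿cong -0#≈0# (λ x y → sym (-‿+-comm x y))

  addClosed-∶ : ∀ {D} → AddClosed D → ∀ B → AddClosed (D ∶ B)
  addClosed-∶ D-add B = record
    { ∈-resp = λ x≈x' xB⊆D y By → ∈-resp D-add (*-congʳ x≈x') (xB⊆D y By)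
    ; 0∈     = λ y _ → ∈-resp D-add (sym (zeroˡ y)) (0∈ D-add)
    ; +∈     = λ {x} {x'} xB⊆D x'B⊆D y By →
                 ∈-resp D-add (sym (distribʳ y x x')) (+∈ D-add (xB⊆D y By) (x'B⊆D y By)) }

  ·-intro : ∀ {A B a b} → A a → B b → (A · B) (a * b)
  ·-intro {a = a} {b} Aa Bb = (a , b) ∷ [] , (Aa , Bb) ∷ [] , sym (+-identityʳ (a * b))

  ·-elim : ∀ {A B D} → AddClosed D → (∀ {a b} → A a → B b → D (a * b)) → A · B ⊆ D
  ·-elim {A} {B} {D} D-add ab∈D x (ps , ps∈ , x≈Σ) = ∈-resp D-add (sym x≈Σ) (Σ∈D ps ps∈)
    where
    Σ∈D : ∀ ps → All (λ p → A (proj₁ p) × B (proj₂ p)) ps →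
          D (RingOps.sumL cring (map (λ p → proj₁ p * proj₂ p) ps))
    Σ∈D []       []               = 0∈ D-add
    Σ∈D (_ ∷ ps) ((Aa , Bb) ∷ ps∈) = +∈ D-add (ab∈D Aa Bb) (Σ∈D ps ps∈)

  private
    sumL-++ : ∀ (ps qs : List (Carrier × Carrier)) →
      RingOps.sumL cring (map (λ p → proj₁ p * proj₂ p) (ps ++ qs)) ≈
      RingOps.sumL cring (map (λ p → proj₁ p * proj₂ p) ps) +
      RingOps.sumL cring (map (λ p → proj₁ p * proj₂ p) qs)
    sumL-++ []       qs = sym (+-identityˡ _)
    sumL-++ (p ∷ ps) qs = trans (+-congˡ (sumL-++ ps qs)) (sym (+-assoc _ _ _))

  ·-addClosed : ∀ {A B} → AddClosed (A · B)
  ·-addClosed = record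
    { ∈-resp = λ { x≈y (ps , ps∈ , x≈Σ) → ps , ps∈ , trans (sym x≈y) x≈Σ }
    ; 0∈     = [] , [] , refl
    ; +∈     = λ { (ps , ps∈ , x≈Σ) (qs , qs∈ , y≈Σ) →
                   ps ++ qs , ++⁺ ps∈ qs∈ , trans (+-cong x≈Σ y≈Σ) (sym (sumL-++ ps qs)) } }

  ·-mono : ∀ {A A' B B'} → A ⊆ A' → B ⊆ B' → A · B ⊆ A' · B'
  ·-mono A⊆A' B⊆B' = ·-elim ·-addClosed (λ {a} {b} Aa Bb → ·-intro (A⊆A' a Aa) (B⊆B' b Bb))

  ·-cong : ∀ {A A' B B'} → A ≐ A' → B ≐ B' → A · B ≐ A' · B'
  ·-cong (A⊆A' , A'⊆A) (B⊆B' , B'⊆B) = ·-mono A⊆A' B⊆B' , ·-mono A'⊆A B'⊆B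

  ·-congˡ : ∀ {A B B'} → B ≐ B' → A · B ≐ A · B'
  ·-congˡ = ·-cong ≐-refl

  ·-congʳ : ∀ {A A' B} → A ≐ A' → A · B ≐ A' · B
  ·-congʳ A≐A' = ·-cong A≐A' ≐-refl

  ·-comm : ∀ {A B} → A · B ≐ B · A
  ·-comm = swap , swap
    where
    swap : ∀ {A B} → A · B ⊆ B · A
    swap = ·-elim ·-addClosed (λ {a} {b} Aa Bb → ∈-resp ·-addClosed (*-comm b a) (·-intro Bb Aa))

  ·-assoc : ∀ {A B C} → (A · B) · C ≐ A · (B · C)
  ·-assoc {A} {B} {C} =
    ·-elim ·-addClosed (λ {ab} {c} ab∈ Cc →
      ·-elim {D = λ x → (A · (B · C)) (x * c)} (addClosed-*ʳ ·-addClosed c)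
        (λ {a} {b} Aa Bb → ∈-resp ·-addClosed (sym (*-assoc a b c)) (·-intro Aa (·-intro Bb Cc))) ab ab∈) ,
    ·-elim ·-addClosed (λ {a} {bc} Aa bc∈ →
      ·-elim {D = λ x → ((A · B) · C) (a * x)} (addClosed-*ˡ ·-addClosed a)
        (λ {b} {c} Bb Cc → ∈-resp ·-addClosed (*-assoc a b c) (·-intro (·-intro Aa Bb) Cc)) bc bc∈)

  ·⊆⇒⊆∶ : ∀ {X D E} → X · D ⊆ E → X ⊆ (E ∶ D)
  ·⊆⇒⊆∶ XD⊆E x Xx y Dy = XD⊆E (x * y) (·-intro Xx Dy)

  ∶-·⊆ : ∀ {D E} → AddClosed E → (E ∶ D) · D ⊆ E
  ∶-·⊆ E-add = ·-elim E-add (λ {x} {y} xD⊆E Dy → xD⊆E y Dy)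

  ·-isSubmodule : ∀ {R A B} → IsSubmodule K R B → IsSubmodule K R (A · B)
  ·-isSubmodule {A = A} {B} B-sub = record
    { resp       = ∈-resp ·-addClosed
    ; has-0      = 0∈ ·-addClosed
    ; +-closed   = +∈ ·-addClosed
    ; neg-closed = λ {x} → ·-elim {D = λ x → (A · B) (- x)} (addClosed-neg ·-addClosed)
        (λ {a} {b} Aa Bb → ∈-resp ·-addClosed (sym (-‿distribʳ-* a b)) (·-intro Aa (neg-closed Bb))) x
    ; R-closed   = λ {r} {x} Rr → ·-elim {D = λ x → (A · B) (r * x)} (addClosed-*ˡ ·-addClosed r)
        (λ {a} {b} Aa Bb → ∈-resp ·-addClosed (solve-* 3 (λ r a b → a ⊛ (r ⊛ b) ≋ r ⊛ (a ⊛ b)) refl r a b)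
          (·-intro Aa (R-closed Rr Bb))) x }
    where open IsSubmodule B-sub

  ∩-isSubmodule : ∀ {R A B} → IsSubmodule K R A → IsSubmodule K R B → IsSubmodule K R (A ∩ B)
  ∩-isSubmodule A-sub B-sub = record
    { resp       = λ x≈y (Ax , Bx) → A.resp x≈y Ax , B.resp x≈y Bx
    ; has-0      = A.has-0 , B.has-0
    ; +-closed   = λ (Ax , Bx) (Ay , By) → A.+-closed Ax Ay , B.+-closed Bx By
    ; neg-closed = λ (Ax , Bx) → A.neg-closed Ax , B.neg-closed Bx
    ; R-closed   = λ Rr (Ax , Bx) → A.R-closed Rr Ax , B.R-closed Rr Bx }
    where
    module A = IsSubmodule A-sub
    module B = IsSubmodule B-sub

  ·-extension-homo : ∀ {S} → S · S ≐ S → ∀ A B → (A · B) · S ≐ (A · S) · (B · S)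
  ·-extension-homo {S} SS≐S A B = begin-equality
    (A · B) · S        ≈⟨ ·-congˡ SS≐S ⟨
    (A · B) · (S · S)  ≈⟨ ·-assoc ⟩
    A · (B · (S · S))  ≈⟨ ·-congˡ ·-assoc ⟨
    A · ((B · S) · S)  ≈⟨ ·-congˡ ·-comm ⟩
    A · (S · (B · S))  ≈⟨ ·-assoc ⟨
    (A · S) · (B · S)  ∎
    where open ⊆-Reasoning

  record SplitsOne (c a : Subset K) : Set where
    field
      α g   : Carrier
      α∈a   : a α
      g∈c   : c g
      α+g≈1 : α + g ≈ 1#

  splitsOne-via : ∀ {c a A} (split : SplitsOne c a) → A (SplitsOne.α split) → SplitsOne c A
  splitsOne-via split Aα = record { SplitsOne split hiding (α∈a) ; α∈a = Aα }

  coprime⇒splitsOne : ∀ {R a c} → a ⊕ c ≐ R → R 1# → SplitsOne c a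
  coprime⇒splitsOne a⊕c≐R R1 with proj₂ a⊕c≐R 1# R1
  ... | α , g , α∈a , g∈c , 1≈α+g =
    record { α = α ; g = g ; α∈a = α∈a ; g∈c = g∈c ; α+g≈1 = sym 1≈α+g }

module OrderIdeals (K : NumberField) {R : Subset K} (R-order : IsOrder K R) where
  open NumberField K
  open Subsets K
  open FieldFacts K using (solve-*; _⊛_; _≋_; _⊜_)
  private module R = IsOrder R-order

  0∈R : R 0#
  0∈R = R.resp (-‿inverseʳ 1#) (R.+-closed R.has-1 (R.neg-closed R.has-1))

  R-isSubmodule : IsSubmodule K R R
  R-isSubmodule = record
    { resp = R.resp ; has-0 = 0∈R ; +-closed = R.+-closed ; neg-closed = R.neg-closed ; R-closed = R.*-closed }

  R-isIntegral : IsIntegral K R R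
  R-isIntegral = R-isSubmodule , (λ _ Rx → Rx)

  integral⇒fractional : ∀ {A} → IsIntegral K R A → IsFractional K R A
  integral⇒fractional (A-sub , A⊆R) = A-sub , 1# , 1≉0 , (λ x Ax → R.resp (sym (*-identityˡ x)) (A⊆R x Ax))

  fractional-resp-≐ : ∀ {X Y} → IsFractional K R X → X ≐ Y → IsFractional K R Y
  fractional-resp-≐ (X-sub , l , l≉0 , lX⊆R) (X⊆Y , Y⊆X) = Y-sub , l , l≉0 , (λ x Yx → lX⊆R x (Y⊆X x Yx))
    where
    open IsSubmodule X-sub
    Y-sub : IsSubmodule K R _
    Y-sub = record
      { resp       = λ x≈y Yx → X⊆Y _ (resp x≈y (Y⊆X _ Yx))
      ; has-0      = X⊆Y _ has-0
      ; +-closed   = λ Yx Yy → X⊆Y _ (+-closed (Y⊆X _ Yx) (Y⊆X _ Yy))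
      ; neg-closed = λ Yx → X⊆Y _ (neg-closed (Y⊆X _ Yx))
      ; R-closed   = λ Rr Yx → X⊆Y _ (R-closed Rr (Y⊆X _ Yx)) }

  ⊆·R : ∀ {A} → A ⊆ A · R
  ⊆·R x Ax = ∈-resp ·-addClosed (*-identityʳ x) (·-intro Ax R.has-1)

  R·-identity : ∀ {A} → IsSubmodule K R A → R · A ≐ A
  R·-identity A-sub =
    ·-elim (submodule⇒addClosed A-sub) (IsSubmodule.R-closed A-sub) ,
    (λ x Ax → ∈-resp ·-addClosed (*-identityˡ x) (·-intro R.has-1 Ax))

  ·R-identity : ∀ {A} → IsSubmodule K R A → A · R ≐ A
  ·R-identity A-sub = ≐-trans ·-comm (R·-identity A-sub)

  R·R≐R : R · R ≐ R
  R·R≐R = R·-identity R-isSubmodule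

  ≐∶R : ∀ {A} → IsSubmodule K R A → A ≐ (A ∶ R)
  ≐∶R A-sub = ·⊆⇒⊆∶ (proj₁ (·R-identity A-sub)) ,
              (λ x xR⊆A → IsSubmodule.resp A-sub (*-identityʳ x) (xR⊆A 1# R.has-1))

  num⊆quotient : ∀ {a b} → IsSubmodule K R a → b ⊆ R → a ⊆ (a ∶ b)
  num⊆quotient a-sub b⊆R x ax y by = IsSubmodule.resp a-sub (*-comm y x) (IsSubmodule.R-closed a-sub (b⊆R y by) ax)

  num·inverse⊆quotient : ∀ {a b B} → IsSubmodule K R a → b · B ⊆ R → a · B ⊆ (a ∶ b)
  num·inverse⊆quotient {a} {b} a-sub bB⊆R = ·-elim (addClosed-∶ (submodule⇒addClosed a-sub) b)
    (λ {x} {z} ax Bz y by → resp (solve-* 3 (λ x y z → (y ⊛ z) ⊛ x ≋ (x ⊛ z) ⊛ y) refl x y z)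
                                (R-closed (bB⊆R (y * z) (·-intro by Bz)) ax))
    where open IsSubmodule a-sub

  quotient·den≐num : ∀ {A a b B} → IsSubmodule K R a → b · B ≐ R → A ≐ (a ∶ b) → A · b ≐ a
  quotient·den≐num {A} {a} {b} {B} a-sub bB≐R A≐a∶b = A·b⊆a , a⊆A·b
    where
    open ⊆-Reasoning
    A·b⊆a : A · b ⊆ a
    A·b⊆a = begin
      A · b      ≲⟨ ·-mono (proj₁ A≐a∶b) ⊆-refl ⟩
      (a ∶ b) · b ≲⟨ ∶-·⊆ (submodule⇒addClosed a-sub) ⟩
      a          ∎
    a⊆A·b : a ⊆ A · b
    a⊆A·b = begin
      a            ≲⟨ ⊆·R ⟩
      a · R        ≈⟨ ·-congˡ bB≐R ⟨
      a · (b · B)  ≈⟨ ·-congˡ ·-comm ⟩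
      a · (B · b)  ≈⟨ ·-assoc ⟨
      (a · B) · b  ≲⟨ ·-mono (⊆-trans (num·inverse⊆quotient a-sub (proj₁ bB≐R)) (proj₂ A≐a∶b)) ⊆-refl ⟩
      A · b        ∎

  inverse≐R∶ : ∀ {b B} → IsSubmodule K R B → b · B ≐ R → B ≐ (R ∶ b)
  inverse≐R∶ {b} {B} B-sub bB≐R = ·⊆⇒⊆∶ (⊆-trans (proj₁ ·-comm) (proj₁ bB≐R)) , R∶b⊆B
    where
    open ⊆-Reasoning
    R∶b⊆B : (R ∶ b) ⊆ B
    R∶b⊆B = begin
      (R ∶ b)            ≲⟨ ⊆·R ⟩
      (R ∶ b) · R        ≈⟨ ·-congˡ bB≐R ⟨
      (R ∶ b) · (b · B)  ≈⟨ ·-assoc ⟨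
      ((R ∶ b) · b) · B  ≲⟨ ·-mono (∶-·⊆ (submodule⇒addClosed R-isSubmodule)) ⊆-refl ⟩
      R · B              ≈⟨ R·-identity B-sub ⟩
      B                  ∎

  module Modulus {c} (c-integral : IsIntegral K R c) where
    private module c = IsSubmodule (proj₁ c-integral)

    splitsOne⇒coprime : ∀ {a} → IsIntegral K R a → SplitsOne c a → a ⊕ c ≐ R
    splitsOne⇒coprime (a-sub , a⊆R) split =
      (λ { x (y , z , ay , cz , x≈y+z) → R.resp (sym x≈y+z) (R.+-closed (a⊆R y ay) (proj₂ c-integral z cz)) }) ,
      (λ x Rx → x * α , x * g , IsSubmodule.R-closed a-sub Rx α∈a , c.R-closed Rx g∈c ,
                trans (sym (*-identityʳ x)) (trans (*-congˡ (sym α+g≈1)) (distribˡ x α g)))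
      where open SplitsOne split

    R⊕c≐R : R ⊕ c ≐ R
    R⊕c≐R = splitsOne⇒coprime R-isIntegral
      (record { α = 1# ; g = 0# ; α∈a = R.has-1 ; g∈c = c.has-0 ; α+g≈1 = +-identityʳ 1# })

    record Presentation (X : Subset K) : Set₁ where
      field
        a b b⁻¹          : Subset K
        a-integral       : IsIntegral K R a
        b-integral       : IsIntegral K R b
        b⁻¹-fractional   : IsFractional K R b⁻¹
        b·b⁻¹≐R          : b · b⁻¹ ≐ R
        a⊕c≐R            : a ⊕ c ≐ R
        b⊕c≐R            : b ⊕ c ≐ R
        X≐a∶b            : X ≐ (a ∶ b)

    presentation : ∀ {X} → CoprimeTo K R c X → Presentation X
    presentation (a , b , a-int , b-int , (_ , b⁻¹ , b⁻¹-frac , b·b⁻¹≐R) , a⊕c≐R , b⊕c≐R , X≐a∶b) =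
      record { a = a ; b = b ; b⁻¹ = b⁻¹ ; a-integral = a-int ; b-integral = b-int ; b⁻¹-fractional = b⁻¹-frac
             ; b·b⁻¹≐R = b·b⁻¹≐R ; a⊕c≐R = a⊕c≐R ; b⊕c≐R = b⊕c≐R ; X≐a∶b = X≐a∶b }

    coprimeTo : ∀ {X} → Presentation X → CoprimeTo K R c X
    coprimeTo P = a , b , a-integral , b-integral ,
                  (integral⇒fractional b-integral , b⁻¹ , b⁻¹-fractional , b·b⁻¹≐R) ,
                  a⊕c≐R , b⊕c≐R , X≐a∶b
      where open Presentation P

    numerator⊆ : ∀ {X} (P : Presentation X) → Presentation.a P ⊆ X
    numerator⊆ P = ⊆-trans (num⊆quotient (proj₁ a-integral) (proj₂ b-integral)) (proj₂ X≐a∶b)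
      where open Presentation P

    InJ-resp-≐ : ∀ {X Y} → InJ K R c X → X ≐ Y → InJ K R c Y
    InJ-resp-≐ (X-frac , a , b , a-int , b-int , b-inv , a⊕c≐R , b⊕c≐R , X≐a∶b) X≐Y =
      fractional-resp-≐ X-frac X≐Y ,
      a , b , a-int , b-int , b-inv , a⊕c≐R , b⊕c≐R , ≐-trans (≐-sym X≐Y) X≐a∶b

    intCoprime⇒InJ : ∀ {A} → IntCoprime K R c A → InJ K R c A
    intCoprime⇒InJ {A} (A-int , A⊕c≐R) = integral⇒fractional A-int , coprimeTo (record
      { a = A ; b = R ; b⁻¹ = R ; a-integral = A-int ; b-integral = R-isIntegral
      ; b⁻¹-fractional = integral⇒fractional R-isIntegral ; b·b⁻¹≐R = R·R≐R
      ; a⊕c≐R = A⊕c≐R ; b⊕c≐R = R⊕c≐R ; X≐a∶b = ≐∶R (proj₁ A-int) })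

    R∈J : InJ K R c R
    R∈J = intCoprime⇒InJ (R-isIntegral , R⊕c≐R)

    inverse∈J : ∀ {b B} → IntCoprime K R c b → IsFractional K R B → b · B ≐ R → InJ K R c B
    inverse∈J {b} {B} (b-int , b⊕c≐R) B-frac b·B≐R = B-frac , coprimeTo (record
      { a = R ; b = b ; b⁻¹ = B ; a-integral = R-isIntegral ; b-integral = b-int
      ; b⁻¹-fractional = B-frac ; b·b⁻¹≐R = b·B≐R
      ; a⊕c≐R = R⊕c≐R ; b⊕c≐R = b⊕c≐R ; X≐a∶b = inverse≐R∶ (proj₁ B-frac) b·B≐R })

module MultExtensionUniqueness (K : NumberField) {R S c : Subset K} (R-order : IsOrder K R) (S-order : IsOrder K S)
  (c-integral : IsIntegral K R c) (f : Subset K → Subset K) (fR≐S : _≐K_ K (f R) S) where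
  open Subsets K
  open OrderIdeals K R-order
  open Modulus c-integral
  private module S = OrderIdeals K S-order

  multExtension≐num·inverse : ∀ {H H'} → IsMultExtension K c R S f H → IsMultExtension K c R S f H' →
    ∀ {X} → InJ K R c X → (P : Presentation X) → H X ≐ f (Presentation.a P) · H' (Presentation.b⁻¹ P)
  multExtension≐num·inverse {H} {H'} H-ext H'-ext {X} X∈J P = begin-equality
    H X                    ≈⟨ S.·R-identity (proj₁ (proj₁ (H.maps-J X X∈J))) ⟨
    H X · S                ≈⟨ ·-congˡ S≐H'b·H'b⁻¹ ⟩
    H X · (H' b · H' b⁻¹)  ≈⟨ ·-assoc ⟨
    (H X · H' b) · H' b⁻¹  ≈⟨ ·-congʳ (·-congˡ H'b≐Hb) ⟩
    (H X · H b) · H' b⁻¹   ≈⟨ ·-congʳ (H.mult X b X∈J b∈J) ⟨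
    H (X · b) · H' b⁻¹     ≈⟨ ·-congʳ (H.resp-≐ (X · b) a (InJ-resp-≐ a∈J (≐-sym X·b≐a)) a∈J X·b≐a) ⟩
    H a · H' b⁻¹           ≈⟨ ·-congʳ (H.extends a (a-integral , a⊕c≐R)) ⟩
    f a · H' b⁻¹           ∎
    where
    open ⊆-Reasoning
    open Presentation P
    module H = IsMultExtension H-ext
    module H' = IsMultExtension H'-ext
    b-coprime : IntCoprime K R c b
    b-coprime = b-integral , b⊕c≐R
    a∈J = intCoprime⇒InJ (a-integral , a⊕c≐R)
    b∈J = intCoprime⇒InJ b-coprime
    H'b≐Hb : H' b ≐ H b
    H'b≐Hb = ≐-trans (H'.extends b b-coprime) (≐-sym (H.extends b b-coprime))
    X·b≐a : X · b ≐ a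
    X·b≐a = quotient·den≐num (proj₁ a-integral) b·b⁻¹≐R X≐a∶b
    S≐H'b·H'b⁻¹ : S ≐ H' b · H' b⁻¹
    S≐H'b·H'b⁻¹ = begin-equality
      S              ≈⟨ fR≐S ⟨
      f R            ≈⟨ H'.extends R (R-isIntegral , R⊕c≐R) ⟨
      H' R           ≈⟨ H'.resp-≐ R (b · b⁻¹) R∈J (InJ-resp-≐ R∈J (≐-sym b·b⁻¹≐R)) (≐-sym b·b⁻¹≐R) ⟩
      H' (b · b⁻¹)   ≈⟨ H'.mult b b⁻¹ b∈J (inverse∈J b-coprime b⁻¹-fractional b·b⁻¹≐R) ⟩
      H' b · H' b⁻¹  ∎

  multExtension-unique : ∀ {F} → IsMultExtension K c R S f F →
    ∀ G → IsMultExtension K c R S f G → ∀ X → InJ K R c X → G X ≐ F X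
  multExtension-unique F-ext G G-ext X X∈J@(_ , X-coprime) = ≐-trans
    (multExtension≐num·inverse G-ext F-ext X∈J P) (≐-sym (multExtension≐num·inverse F-ext F-ext X∈J P))
    where P = presentation X-coprime

module ContractionExtension (K : NumberField) {O O' c : Subset K} (O-order : IsOrder K O) (O'-order : IsOrder K O')
  (O⊆O' : _⊆K_ K O O') (c-integral : IsIntegral K O' c) (c⊆f : _⊆K_ K c (conductor K O O')) where
  open NumberField K
  open FieldFacts K
  open Subsets K
  open RingProperties ring using (-‿distribʳ-*)
  private
    module O = IsOrder O-order
    module O' = IsOrder O'-order
    module c = IsSubmodule (proj₁ c-integral)
    module OI = OrderIdeals K O-order
    module OI' = OrderIdeals K O'-order

  c⊆O' : c ⊆ O'
  c⊆O' = proj₂ c-integral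

  c·O'⊆O : ∀ {g x} → c g → O' x → O (g * x)
  c·O'⊆O {g} {x} g∈c O'x = proj₂ (c⊆f g g∈c) x O'x

  c⊆O : c ⊆ O
  c⊆O g g∈c = O.resp (*-identityʳ g) (c·O'⊆O g∈c O'.has-1)

  restrictScalars : ∀ {X} → IsSubmodule K O' X → IsSubmodule K O X
  restrictScalars X-sub = record
    { resp = resp ; has-0 = has-0 ; +-closed = +-closed ; neg-closed = neg-closed
    ; R-closed = λ Or Xx → R-closed (O⊆O' _ Or) Xx }
    where open IsSubmodule X-sub

  private
    module M = OI.Modulus (restrictScalars (proj₁ c-integral) , c⊆O)
    module M' = OI'.Modulus c-integral

  splitsOne-α∈O : ∀ {a} (split : SplitsOne c a) → O (SplitsOne.α split)
  splitsOne-α∈O split = O.resp 1-g≈α (O.+-closed O.has-1 (O.neg-closed (c⊆O g g∈c)))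
    where
    open SplitsOne split
    open ≈-Reasoning setoid
    1-g≈α : 1# + - g ≈ α
    1-g≈α = begin
      1# + - g       ≈⟨ +-congʳ α+g≈1 ⟨
      α + g + - g    ≈⟨ +-assoc α g (- g) ⟩
      α + (g + - g)  ≈⟨ +-congˡ (-‿inverseʳ g) ⟩
      α + 0#         ≈⟨ +-identityʳ α ⟩
      α              ∎

  splitsOne-· : ∀ {A B D} → SplitsOne c A → SplitsOne c B →
    (∀ {a b} → O a → O b → A a → B b → D (a * b)) → SplitsOne c D
  splitsOne-· A-split B-split ab∈D = record
    { α     = A.α * B.α
    ; g     = A.α * B.g + A.g
    ; α∈a   = ab∈D (splitsOne-α∈O A-split) (splitsOne-α∈O B-split) A.α∈a B.α∈a
    ; g∈c   = c.+-closed (c.R-closed (O⊆O' _ (splitsOne-α∈O A-split)) B.g∈c) A.g∈c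
    ; α+g≈1 = begin
        A.α * B.α + (A.α * B.g + A.g)  ≈⟨ solve 4 (λ a b g h → a ⊠ b ⊞ (a ⊠ h ⊞ g) ⊜ a ⊠ (b ⊞ h) ⊞ g)
                                                refl A.α B.α A.g B.g ⟩
        A.α * (B.α + B.g) + A.g        ≈⟨ +-congʳ (*-congˡ B.α+g≈1) ⟩
        A.α * 1# + A.g                 ≈⟨ +-congʳ (*-identityʳ A.α) ⟩
        A.α + A.g                      ≈⟨ A.α+g≈1 ⟩
        1#                             ∎ }
    where
    open ≈-Reasoning setoid
    module A = SplitsOne A-split
    module B = SplitsOne B-split

  O₍c₎ : Subset K
  O₍c₎ x = SplitsOne c (λ s → O (s * x))

  O⊆O₍c₎ : O ⊆ O₍c₎
  O⊆O₍c₎ x Ox = record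
    { α = 1# ; g = 0# ; α∈a = O.resp (sym (*-identityˡ x)) Ox ; g∈c = c.has-0 ; α+g≈1 = +-identityʳ 1# }

  O₍c₎∩O'⊆O : O₍c₎ ∩ O' ⊆ O
  O₍c₎∩O'⊆O x (x-split , O'x) = O.resp (*-splits x α+g≈1) (O.+-closed α∈a (c·O'⊆O g∈c O'x))
    where open SplitsOne x-split

  O₍c₎-isSubmodule : IsSubmodule K O O₍c₎
  O₍c₎-isSubmodule = record
    { resp       = λ x≈y x-split → splitsOne-via x-split (O.resp (*-congˡ x≈y) (SplitsOne.α∈a x-split))
    ; has-0      = O⊆O₍c₎ 0# OI.0∈R
    ; +-closed   = λ {x} {y} x-split y-split → splitsOne-· x-split y-split (λ {s} {t} Os Ot Osx Oty →
        O.resp (trans (+-cong (solve-* 3 (λ s t x → t ⊛ (s ⊛ x) ≋ (s ⊛ t) ⊛ x) refl s t x)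
                              (solve-* 3 (λ s t y → s ⊛ (t ⊛ y) ≋ (s ⊛ t) ⊛ y) refl s t y))
                      (sym (distribˡ (s * t) x y)))
               (O.+-closed (O.*-closed Ot Osx) (O.*-closed Os Oty)))
    ; neg-closed = λ {x} x-split →
        splitsOne-via x-split (O.resp (-‿distribʳ-* _ x) (O.neg-closed (SplitsOne.α∈a x-split)))
    ; R-closed   = λ {r} {x} Or x-split → splitsOne-via x-split
        (O.resp (solve-* 3 (λ r s x → r ⊛ (s ⊛ x) ≋ s ⊛ (r ⊛ x)) refl r _ x)
                (O.*-closed Or (SplitsOne.α∈a x-split))) }

  O₍c₎-*-closed : ∀ {x y} → O₍c₎ x → O₍c₎ y → O₍c₎ (x * y)
  O₍c₎-*-closed {x} {y} x-split y-split = splitsOne-· x-split y-split (λ {s} {t} _ _ Osx Oty →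
    O.resp (solve-* 4 (λ s x t y → (s ⊛ x) ⊛ (t ⊛ y) ≋ (s ⊛ t) ⊛ (x ⊛ y)) refl s x t y) (O.*-closed Osx Oty))

  Con Ext : Subset K → Subset K
  Con X = X ∩ O₍c₎
  Ext A = A · O'

  Con-isSubmodule : ∀ {X} → IsSubmodule K O' X → IsSubmodule K O (Con X)
  Con-isSubmodule X-sub = ∩-isSubmodule (restrictScalars X-sub) O₍c₎-isSubmodule

  Con-mono : ∀ {X Y} → X ⊆ Y → Con X ⊆ Con Y
  Con-mono X⊆Y x (Xx , x∈O₍c₎) = X⊆Y x Xx , x∈O₍c₎

  Con-cong : ∀ {X Y} → X ≐ Y → Con X ≐ Con Y
  Con-cong (X⊆Y , Y⊆X) = Con-mono X⊆Y , Con-mono Y⊆X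

  Con-integral : ∀ {X} → X ⊆ O' → Con X ≐ X ∩ O
  Con-integral X⊆O' = (λ x (Xx , x∈O₍c₎) → Xx , O₍c₎∩O'⊆O x (x∈O₍c₎ , X⊆O' x Xx)) ,
                      (λ x (Xx , Ox) → Xx , O⊆O₍c₎ x Ox)

  Ext-homo : ∀ A B → Ext (A · B) ≐ Ext A · Ext B
  Ext-homo = ·-extension-homo OI'.R·R≐R

  Ext-O≐O' : Ext O ≐ O'
  Ext-O≐O' = ≐-trans ·-comm (O'·O⊆O' , OI.⊆·R)
    where
    O'·O⊆O' : O' · O ⊆ O'
    O'·O⊆O' = ·-elim (submodule⇒addClosed OI'.R-isSubmodule) (λ O'x Oy → O'.*-closed O'x (O⊆O' _ Oy))

  O'∩O≐O : O' ∩ O ≐ O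
  O'∩O≐O = (λ _ → proj₂) , (λ x Ox → O⊆O' x Ox , Ox)

  c·Ext⊆ : ∀ {I g} → IsSubmodule K O I → c g → Ext I ⊆ (λ x → I (g * x))
  c·Ext⊆ {I} {g} I-sub g∈c = ·-elim (addClosed-*ˡ (submodule⇒addClosed I-sub) g) (λ {i} {o} Ii O'o →
    IsSubmodule.resp I-sub (solve-* 3 (λ g i o → (g ⊛ o) ⊛ i ≋ g ⊛ (i ⊛ o)) refl g i o)
      (IsSubmodule.R-closed I-sub (c·O'⊆O g∈c O'o) Ii))

  -- With s + g' = 1 witnessing z ∈ O₍c₎ and α + g = 1 inside I:
  -- z = s z + g' z and s z = α (s z) + g (s z).
  Con∘Ext⊆ : ∀ {I} → IsSubmodule K O I → SplitsOne c I → Con (Ext I) ⊆ I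
  Con∘Ext⊆ {I} I-sub I-split z (z∈Ext , z-split) =
    I.resp (*-splits z s+g'≈1) (I.+-closed sz∈I (c·Ext⊆ I-sub g'∈c z z∈Ext))
    where
    module I = IsSubmodule I-sub
    open SplitsOne I-split
    open SplitsOne z-split using () renaming (α to s; g to g'; α∈a to sz∈O; g∈c to g'∈c; α+g≈1 to s+g'≈1)
    sz∈Ext : Ext I (s * z)
    sz∈Ext = IsSubmodule.R-closed (·-isSubmodule OI'.R-isSubmodule) (O⊆O' s (splitsOne-α∈O z-split)) z∈Ext
    sz∈I : I (s * z)
    sz∈I = I.resp (*-splits (s * z) α+g≈1)
                  (I.+-closed (I.resp (*-comm (s * z) α) (I.R-closed sz∈O α∈a)) (c·Ext⊆ I-sub g∈c (s * z) sz∈Ext))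

  Con∘Ext : ∀ A → InJ K O c A → Con (Ext A) ≐ A
  Con∘Ext A (A-frac , A-coprime) = Con∘Ext⊆ (proj₁ A-frac) (splitsOne-via α-split (M.numerator⊆ P _ α∈a)) , A⊆Con∘Ext
    where
    P = M.presentation A-coprime
    open M.Presentation P
    α-split = coprime⇒splitsOne a⊕c≐R O.has-1
    β-split = coprime⇒splitsOne b⊕c≐R O.has-1
    open SplitsOne α-split using (α∈a)
    open SplitsOne β-split using () renaming (α to β; α∈a to β∈b)
    A⊆Con∘Ext : A ⊆ Con (Ext A)
    A⊆Con∘Ext x Ax = OI'.⊆·R x Ax ,
      splitsOne-via β-split (O.resp (*-comm x β) (proj₂ a-integral _ (proj₁ X≐a∶b x Ax β β∈b)))

  module InJ' {X} (X-frac : IsFractional K O' X) (P : M'.Presentation X) where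
    open M'.Presentation P
    private
      module X = IsSubmodule (proj₁ X-frac)
      module a = IsSubmodule (proj₁ a-integral)
      α-split = coprime⇒splitsOne a⊕c≐R O'.has-1
      β-split = coprime⇒splitsOne b⊕c≐R O'.has-1
      open SplitsOne β-split using () renaming (α to β; g to g'; α∈a to β∈b; g∈c to g'∈c; α+g≈1 to β+g'≈1)

    a∩O⊆Con : a ∩ O ⊆ Con X
    a∩O⊆Con x (ax , Ox) = M'.numerator⊆ P x ax , O⊆O₍c₎ x Ox

    a∩O-splitsOne : SplitsOne c (a ∩ O)
    a∩O-splitsOne = splitsOne-via α-split (SplitsOne.α∈a α-split , splitsOne-α∈O α-split)

    β∈O : O β
    β∈O = splitsOne-α∈O β-split

    a⊆Ext∘Con : a ⊆ Ext (Con X)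
    a⊆Ext∘Con y ay = ∈-resp ·-addClosed (*-splits y α+g≈1) (+∈ ·-addClosed
      (·-intro (a∩O⊆Con α (α∈a , splitsOne-α∈O α-split)) (proj₂ a-integral y ay))
      (OI'.⊆·R _ (a∩O⊆Con (g * y) (a.R-closed (c⊆O' g g∈c) ay , c·O'⊆O g∈c (proj₂ a-integral y ay)))))
      where open SplitsOne α-split

    Ext∘Con : Ext (Con X) ≐ X
    Ext∘Con = ⊆-trans (·-mono (λ _ → proj₁) ⊆-refl) (proj₁ (OI'.·R-identity (proj₁ X-frac))) , X⊆Ext∘Con
      where
      X⊆Ext∘Con : X ⊆ Ext (Con X)
      X⊆Ext∘Con x Xx =
        ∈-resp ·-addClosed (*-splits x β+g'≈1) (+∈ ·-addClosed (a⊆Ext∘Con _ βx∈a) (OI'.⊆·R _ g'x∈Con))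
        where
        βx∈a : a (β * x)
        βx∈a = a.resp (*-comm x β) (proj₁ X≐a∶b x Xx β β∈b)
        g'x∈Con : Con X (g' * x)
        g'x∈Con = X.R-closed (c⊆O' g' g'∈c) Xx , splitsOne-via β-split
          (O.resp (solve-* 3 (λ g b x → g ⊛ (b ⊛ x) ≋ b ⊛ (g ⊛ x)) refl g' β x)
                  (c·O'⊆O g'∈c (proj₂ a-integral _ βx∈a)))

    Con-splitsOne : SplitsOne c (Con X)
    Con-splitsOne = splitsOne-via a∩O-splitsOne (a∩O⊆Con _ (SplitsOne.α∈a a∩O-splitsOne))

    Con≐quotient : Con X ≐ ((a ∩ O) ∶ (b ∩ O))
    Con≐quotient = Con⊆quotient , quotient⊆Con
      where
      Con⊆quotient : Con X ⊆ ((a ∩ O) ∶ (b ∩ O))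
      Con⊆quotient x (Xx , x∈O₍c₎) y (by , Oy) =
        xy∈a , O₍c₎∩O'⊆O (x * y) (xy∈O₍c₎ , proj₂ a-integral _ xy∈a)
        where
        xy∈a = proj₁ X≐a∶b x Xx y by
        xy∈O₍c₎ = Oc.resp (*-comm y x) (Oc.R-closed Oy x∈O₍c₎)
          where module Oc = IsSubmodule O₍c₎-isSubmodule
      quotient⊆Con : ((a ∩ O) ∶ (b ∩ O)) ⊆ Con X
      quotient⊆Con x x[b∩O]⊆a∩O =
        proj₂ X≐a∶b x xb⊆a , splitsOne-via β-split (O.resp (*-comm x β) (proj₂ xβ∈a∩O))
        where
        xβ∈a∩O = x[b∩O]⊆a∩O β (β∈b , β∈O)
        xb⊆a : ∀ y → b y → a (x * y)
        xb⊆a y by = a.resp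
          (trans (+-congʳ (solve-* 3 (λ x y β → y ⊛ (x ⊛ β) ≋ x ⊛ (β ⊛ y)) refl x y β))
                 (trans (sym (distribˡ x (β * y) (g' * y))) (*-congˡ (*-splits y β+g'≈1))))
          (a.+-closed (a.R-closed (proj₂ b-integral y by) (proj₁ xβ∈a∩O))
                      (proj₁ (x[b∩O]⊆a∩O (g' * y) (IsSubmodule.R-closed (proj₁ b-integral) (c⊆O' g' g'∈c) by ,
                                                   c·O'⊆O g'∈c (proj₂ b-integral y by)))))

    -- β is a denominator; when β ≈ 0 we have g' ≈ 1 ∈ c, and c O' ⊆ O makes the denominator l of X work.
    Con-isFractional : IsFractional K O (Con X)
    Con-isFractional with β ≈0? | proj₂ X-frac
    ... | no β≉0  | _ = Con-isSubmodule (proj₁ X-frac) , β , β≉0 ,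
                        (λ x x∈Con → O.resp (*-comm x β) (proj₂ (proj₁ Con≐quotient x x∈Con β (β∈b , β∈O))))
    ... | yes β≈0 | l , l≉0 , lX⊆O' = Con-isSubmodule (proj₁ X-frac) , l , l≉0 ,
                        (λ x x∈Con → O.resp (trans (*-congʳ g'≈1) (*-identityˡ _))
                                            (c·O'⊆O g'∈c (lX⊆O' x (proj₁ x∈Con))))
      where
      g'≈1 : g' ≈ 1#
      g'≈1 = trans (sym (+-identityˡ g')) (trans (+-congʳ (sym β≈0)) β+g'≈1)

  private
    module InJ'-of {X} (X∈J : InJ K O' c X) = InJ' (proj₁ X∈J) (M'.presentation (proj₂ X∈J))

  Con-mult : ∀ X Y → InJ K O' c X → InJ K O' c Y → Con (X · Y) ≐ Con X · Con Y
  Con-mult X Y X∈J Y∈J =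
    Con-XY⊆ , ·-elim (submodule⇒addClosed (Con-isSubmodule (·-isSubmodule (proj₁ (proj₁ Y∈J)))))
    (λ (Xx , x∈O₍c₎) (Yy , y∈O₍c₎) → ·-intro Xx Yy , O₍c₎-*-closed x∈O₍c₎ y∈O₍c₎)
    where
    module X = InJ'-of X∈J
    module Y = InJ'-of Y∈J
    open ⊆-Reasoning
    Con-XY⊆ : Con (X · Y) ⊆ Con X · Con Y
    Con-XY⊆ = begin
      Con (X · Y)                          ≈⟨ Con-cong (·-cong X.Ext∘Con Y.Ext∘Con) ⟨
      Con (Ext (Con X) · Ext (Con Y))      ≈⟨ Con-cong (Ext-homo (Con X) (Con Y)) ⟨
      Con (Ext (Con X · Con Y))            ≲⟨ Con∘Ext⊆ (·-isSubmodule (Con-isSubmodule (proj₁ (proj₁ Y∈J))))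
                                                 (splitsOne-· X.Con-splitsOne Y.Con-splitsOne (λ _ _ → ·-intro)) ⟩
      Con X · Con Y                        ∎

  ∩O-isIntegral : ∀ {a} → IsIntegral K O' a → IsIntegral K O (a ∩ O)
  ∩O-isIntegral (a-sub , _) = ∩-isSubmodule (restrictScalars a-sub) OI.R-isSubmodule , (λ _ → proj₂)

  ∩O-coprime : ∀ {a} → IsIntegral K O' a → a ⊕ c ≐ O' → (a ∩ O) ⊕ c ≐ O
  ∩O-coprime a-int a⊕c≐O' = M.splitsOne⇒coprime (∩O-isIntegral a-int)
    (splitsOne-via α-split (SplitsOne.α∈a α-split , splitsOne-α∈O α-split))
    where α-split = coprime⇒splitsOne a⊕c≐O' O'.has-1

  Con-maps-J : ∀ X → InJ K O' c X → InJ K O c (Con X)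
  Con-maps-J X X∈J@(X-frac , X-coprime) = X.Con-isFractional , M.coprimeTo (record
    { a = a ∩ O ; b = b ∩ O ; b⁻¹ = Con b⁻¹
    ; a-integral = ∩O-isIntegral a-integral ; b-integral = ∩O-isIntegral b-integral
    ; b⁻¹-fractional = B.Con-isFractional ; b·b⁻¹≐R = b∩O·Con-b⁻¹≐O
    ; a⊕c≐R = ∩O-coprime a-integral a⊕c≐R ; b⊕c≐R = ∩O-coprime b-integral b⊕c≐R
    ; X≐a∶b = X.Con≐quotient })
    where
    module X = InJ'-of X∈J
    open M'.Presentation (M'.presentation X-coprime)
    b∈J = M'.intCoprime⇒InJ (b-integral , b⊕c≐R)
    b⁻¹∈J = M'.inverse∈J (b-integral , b⊕c≐R) b⁻¹-fractional b·b⁻¹≐R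
    module B = InJ'-of b⁻¹∈J
    open ⊆-Reasoning
    b∩O·Con-b⁻¹≐O : (b ∩ O) · Con b⁻¹ ≐ O
    b∩O·Con-b⁻¹≐O = begin-equality
      (b ∩ O) · Con b⁻¹  ≈⟨ ·-congʳ (Con-integral (proj₂ b-integral)) ⟨
      Con b · Con b⁻¹    ≈⟨ Con-mult b b⁻¹ b∈J b⁻¹∈J ⟨
      Con (b · b⁻¹)      ≈⟨ Con-cong b·b⁻¹≐R ⟩
      Con O'             ≈⟨ Con-integral ⊆-refl ⟩
      O' ∩ O             ≈⟨ O'∩O≐O ⟩
      O                  ∎

  Ext-isFractional : ∀ {A} → IsFractional K O A → IsFractional K O' (Ext A)
  Ext-isFractional (_ , l , l≉0 , lA⊆O) = ·-isSubmodule OI'.R-isSubmodule , l , l≉0 ,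
    ·-elim (addClosed-*ˡ (submodule⇒addClosed OI'.R-isSubmodule) l)
      (λ {x} {o} Ax O'o → O'.resp (*-assoc l x o) (O'.*-closed (O⊆O' _ (lA⊆O x Ax)) O'o))

  Ext-isIntegral : ∀ {a} → IsIntegral K O a → IsIntegral K O' (Ext a)
  Ext-isIntegral (_ , a⊆O) = ·-isSubmodule OI'.R-isSubmodule ,
    ·-elim (submodule⇒addClosed OI'.R-isSubmodule) (λ {x} ax O'o → O'.*-closed (O⊆O' x (a⊆O x ax)) O'o)

  Ext-coprime : ∀ {a} → IsIntegral K O a → a ⊕ c ≐ O → Ext a ⊕ c ≐ O'
  Ext-coprime a-int a⊕c≐O = M'.splitsOne⇒coprime (Ext-isIntegral a-int)
    (splitsOne-via α-split (OI'.⊆·R _ (SplitsOne.α∈a α-split)))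
    where α-split = coprime⇒splitsOne a⊕c≐O O.has-1

  Ext≐quotient : ∀ {A} (P : M.Presentation A) →
    let open M.Presentation P in Ext A ≐ (Ext a ∶ Ext b)
  Ext≐quotient {A} P = ·⊆⇒⊆∶ ExtA·Extb⊆Exta , quotient⊆ExtA
    where
    open M.Presentation P
    open ⊆-Reasoning
    ExtA·Extb⊆Exta : Ext A · Ext b ⊆ Ext a
    ExtA·Extb⊆Exta = begin
      Ext A · Ext b  ≈⟨ Ext-homo A b ⟨
      Ext (A · b)    ≈⟨ ·-congʳ (OI.quotient·den≐num (proj₁ a-integral) b·b⁻¹≐R X≐a∶b) ⟩
      Ext a          ∎
    quotient⊆ExtA : (Ext a ∶ Ext b) ⊆ Ext A
    quotient⊆ExtA = begin
      (Ext a ∶ Ext b)                  ≲⟨ OI.⊆·R ⟩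
      (Ext a ∶ Ext b) · O              ≈⟨ ·-congˡ b·b⁻¹≐R ⟨
      (Ext a ∶ Ext b) · (b · b⁻¹)      ≈⟨ ·-assoc ⟨
      ((Ext a ∶ Ext b) · b) · b⁻¹      ≲⟨ ·-mono (⊆-trans (·-mono ⊆-refl OI'.⊆·R) (∶-·⊆ ·-addClosed)) ⊆-refl ⟩
      (a · O') · b⁻¹                   ≈⟨ ·-assoc ⟩
      a · (O' · b⁻¹)                   ≈⟨ ·-congˡ ·-comm ⟩
      a · (b⁻¹ · O')                   ≈⟨ ·-assoc ⟨
      (a · b⁻¹) · O'                   ≲⟨ ·-mono (⊆-trans (OI.num·inverse⊆quotient (proj₁ a-integral) (proj₁ b·b⁻¹≐R))
                                                          (proj₂ X≐a∶b)) ⊆-refl ⟩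
      Ext A                            ∎

  Ext-maps-J : ∀ A → InJ K O c A → InJ K O' c (Ext A)
  Ext-maps-J A (A-frac , A-coprime) = Ext-isFractional A-frac , M'.coprimeTo (record
    { a = Ext a ; b = Ext b ; b⁻¹ = Ext b⁻¹
    ; a-integral = Ext-isIntegral a-integral ; b-integral = Ext-isIntegral b-integral
    ; b⁻¹-fractional = Ext-isFractional b⁻¹-fractional ; b·b⁻¹≐R = Ext-b·Ext-b⁻¹≐O'
    ; a⊕c≐R = Ext-coprime a-integral a⊕c≐R ; b⊕c≐R = Ext-coprime b-integral b⊕c≐R
    ; X≐a∶b = Ext≐quotient P })
    where
    P = M.presentation A-coprime
    open M.Presentation P
    open ⊆-Reasoning
    Ext-b·Ext-b⁻¹≐O' : Ext b · Ext b⁻¹ ≐ O'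
    Ext-b·Ext-b⁻¹≐O' = begin-equality
      Ext b · Ext b⁻¹  ≈⟨ Ext-homo b b⁻¹ ⟨
      Ext (b · b⁻¹)    ≈⟨ ·-congʳ b·b⁻¹≐R ⟩
      Ext O            ≈⟨ Ext-O≐O' ⟩
      O'               ∎

  Con-isMultExtension : IsMultExtension K c O' O (λ X → X ∩ O) Con
  Con-isMultExtension = record
    { maps-J  = Con-maps-J
    ; resp-≐  = λ _ _ _ _ → Con-cong
    ; mult    = Con-mult
    ; extends = λ X X-coprime → Con-integral (proj₂ (proj₁ X-coprime)) }

  Ext-isMultExtension : IsMultExtension K c O O' Ext Ext
  Ext-isMultExtension = record
    { maps-J  = Ext-maps-J
    ; resp-≐  = λ _ _ _ _ → ·-congʳ
    ; mult    = λ A B _ _ → Ext-homo A B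
    ; extends = λ _ _ → ≐-refl }

  Con-unique : ∀ G → IsMultExtension K c O' O (λ X → X ∩ O) G → ∀ X → InJ K O' c X → G X ≐ Con X
  Con-unique = MultExtensionUniqueness.multExtension-unique K O'-order O-order c-integral (λ X → X ∩ O) O'∩O≐O
                 Con-isMultExtension

  Ext-unique : ∀ G → IsMultExtension K c O O' Ext G → ∀ A → InJ K O c A → G A ≐ Ext A
  Ext-unique = MultExtensionUniqueness.multExtension-unique K O-order O'-order (restrictScalars (proj₁ c-integral) , c⊆O)
                 Ext Ext-O≐O' Ext-isMultExtension

  Ext∘Con : ∀ X → InJ K O' c X → Ext (Con X) ≐ X
  Ext∘Con X X∈J = InJ'-of.Ext∘Con X∈J


proposition4p8 : (K : NumberField) (O O' m' : Subset K) →
    IsOrder K O → IsOrder K O' → _⊆K_ K O O' →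
    IsIntegral K O' m' → _⊆K_ K m' (conductor K O O') →
    Σ (Subset K → Subset K) (λ Con → Σ (Subset K → Subset K) (λ Ext →
      UniqueMultExtension K m' O' O (λ A' → _∩K_ K A' O) Con ×
      UniqueMultExtension K m' O O' (λ A → _·K_ K A O') Ext ×
      (∀ A → InJ K O m' A → _≐K_ K (Con (Ext A)) A) ×
      (∀ A' → InJ K O' m' A' → _≐K_ K (Ext (Con A')) A')))
proposition4p8 K O O' m' O-order O'-order O⊆O' m'-integral m'⊆f =
  Con , Ext , (Con-isMultExtension , Con-unique) , (Ext-isMultExtension , Ext-unique) , Con∘Ext , Ext∘Con
  where open ContractionExtension K O-order O'-order O⊆O' m'-integral m'⊆f
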